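{- Let $K$ be a real number field and let $\beta_1,\beta_2\in\mathfrak{O}_K^+$ be an integral basis of $\mathfrak{O}_K$ (a $\mathbb{Z}$-basis). If $a,b\in\mathbb{N}$ are nonzero and $\alpha=ab\beta_2-a\beta_1\in\mathfrak{O}_K^+$, then $$\mathrm{Frob}(\beta_1,\beta_2,\alpha)=(a-1)\beta_1+\big(C_\mathbb{Q}(\beta_1,\beta_2,\alpha)\cap\mathfrak{O}_K\big).$$
   Context: A real number field is a number field that is a subfield of $\mathbb{R}$; $\mathfrak{O}_K$ is its ring of integers and $\mathfrak{O}_K^+=\mathfrak{O}_K\cap[0,\infty)$. $\mathbb{N}=\{0,1,2,\dots\}$. For $\alpha_1,\dots,\alpha_n\in\mathfrak{O}_K^+$: $\mathrm{SG}(\alpha_1,\dots,\alpha_n)=\{\sum x_i\alpha_i\mid x_i\in\mathbb{N}\}$; $C_\mathbb{Q}(\alpha_1,\dots,\alpha_n)=\{\sum x_i\alpha_i\mid x_i\in\mathbb{Q}_{\geqslant0}\}$; $\mathrm{Frob}(\alpha_1,\dots,\alpha_n)=\{w\in\mathrm{SG}(\alpha_1,\dots,\alpha_n)\mid w+(C_\mathbb{Q}(\alpha_1,\dots,\alpha_n)\cap\mathfrak{O}_K)\subseteq \mathrm{SG}(\alpha_1,\dots,\alpha_n)\}$. -}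

module Defs where

open import Data.Nat as ℕ using (ℕ; suc)
open import Data.Nat.Divisibility using (_∣_)
open import Data.Integer as ℤ using (ℤ)
open import Data.Rational as ℚ using (ℚ; 0ℚ; _/_)
open import Data.Product using (Σ; ∃; ∃-syntax; _×_; _,_)
open import Data.Sum using (_⊎_)
open import Data.Vec using (Vec; []; _∷_)
open import Relation.Binary.PropositionalEquality using (_≡_)

SquareFree : ℕ → Set
SquareFree d = ∀ (p : ℕ) → p ℕ.* p ∣ d → p ≡ 1

-- The real quadratic field K = ℚ(√d) ⊆ ℝ (√d the positive square root).
-- An element (p , q) represents p + q·√d.
K : Set
K = ℚ × ℚ

ι : ℚ → K
ι r = r , 0ℚ

infixl 6 _⊕_
_⊕_ : K → K → K
(p , q) ⊕ (p' , q') = (p ℚ.+ p') , (q ℚ.+ q')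

infixl 7 _·_
_·_ : ℚ → K → K
r · (p , q) = (r ℚ.* p) , (r ℚ.* q)

0K : K
0K = 0ℚ , 0ℚ

ℕ→ℚ : ℕ → ℚ
ℕ→ℚ n = ℤ.+ n / 1

ℤ→ℚ : ℤ → ℚ
ℤ→ℚ z = z / 1

-- Real order on K: p + q√d ≥ 0 (with √d > 0), decided exactly.
NonNeg : ℕ → K → Set
NonNeg d (p , q) =
  (ℚ.NonNegative p × ℚ.NonNegative q)
  ⊎ (ℚ.NonNegative p × (q ℚ.< 0ℚ) × (ℕ→ℚ d ℚ.* (q ℚ.* q) ℚ.≤ p ℚ.* p))
  ⊎ ((p ℚ.< 0ℚ) × ℚ.NonNegative q × (p ℚ.* p ℚ.≤ ℕ→ℚ d ℚ.* (q ℚ.* q)))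

IsInt : ℚ → Set
IsInt r = ∃[ z ] r ≡ ℤ→ℚ z

trace : K → ℚ
trace (p , q) = p ℚ.+ p

norm : ℕ → K → ℚ
norm d (p , q) = p ℚ.* p ℚ.- ℕ→ℚ d ℚ.* (q ℚ.* q)

-- Ring of integers 𝔒_K: x is an algebraic integer, i.e. its characteristic
-- polynomial X² - tr(x) X + N(x) has integer coefficients.
InO : ℕ → K → Set
InO d x = IsInt (trace x) × IsInt (norm d x)

InO⁺ : ℕ → K → Set
InO⁺ d x = InO d x × NonNeg d x

IsIntegralBasis : ℕ → K → K → Set
IsIntegralBasis d β₁ β₂ =
  InO d β₁ × InO d β₂
  × (∀ x → InO d x → ∃[ m ] ∃[ n ] x ≡ ℤ→ℚ m · β₁ ⊕ ℤ→ℚ n · β₂)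
  × (∀ m n → ℤ→ℚ m · β₁ ⊕ ℤ→ℚ n · β₂ ≡ 0K → (m ≡ ℤ.+ 0) × (n ≡ ℤ.+ 0))

lincomb : ∀ {n} → Vec ℚ n → Vec K n → K
lincomb [] [] = 0K
lincomb (c ∷ cs) (a ∷ as) = c · a ⊕ lincomb cs as

mapℕ : ∀ {n} → Vec ℕ n → Vec ℚ n
mapℕ [] = []
mapℕ (x ∷ xs) = ℕ→ℚ x ∷ mapℕ xs

AllNonNeg : ∀ {n} → Vec ℚ n → Set
AllNonNeg [] = Data.Unit.⊤ where import Data.Unit
AllNonNeg (x ∷ xs) = ℚ.NonNegative x × AllNonNeg xs

SG : ∀ {n} → Vec K n → K → Set
SG αs w = ∃[ xs ] w ≡ lincomb (mapℕ xs) αs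

Cone : ∀ {n} → Vec K n → K → Set
Cone αs w = ∃[ xs ] AllNonNeg xs × (w ≡ lincomb xs αs)

Frob : ℕ → ∀ {n} → Vec K n → K → Set
Frob d αs w = SG αs w × (∀ v → Cone αs v → InO d v → SG αs (w ⊕ v))

{-# OPTIONS --safe #-}
-- In the coordinates (m, n) ↦ mβ₁ + nβ₂ of the integral basis, α = −aβ₁ + abβ₂, so
-- SG(β₁, β₂, α) is the set of points (y₁ − a·y₃, y₂ + ab·y₃) with yᵢ ∈ ℕ, and
-- C_ℚ(β₁, β₂, α) ∩ 𝔒_K is the set C of integer points with n ≥ 0 and bm + n ≥ 0, which is
-- closed under addition. Division with remainder by a shows (a − 1, 0) + C ⊆ SG, hence
-- (a − 1)β₁ + (C_ℚ ∩ 𝔒_K) ⊆ Frob. Conversely, for w = (y₁ − a·y₃, y₂ + ab·y₃) in Frob the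
-- point w + (−(y₁ + 1), b(y₁ + 1)) lies in SG; its first coordinate is below −a·y₃, so it uses
-- at least one more α, which costs ab in the second coordinate and gives b(m − (a − 1)) + n ≥ 0.
-- The converse uses that every ℤ-combination of β₁, β₂ lies in 𝔒_K, i.e. that the trace/norm
-- description of 𝔒_K is closed under addition; for squarefree d this is a parity argument on
-- (2p, 2q).

module Submission where

open import Defs
open import Data.Nat using (ℕ; _*_; _∸_; NonZero)
open import Data.Rational using (_-_)
open import Data.Product using (Σ; ∃-syntax; _×_)
open import Data.Vec using (_∷_; [])
open import Function.Bundles using (_⇔_)
open import Relation.Binary.PropositionalEquality using (_≡_)

import Data.Integer as ℤ
import Data.Integer.DivMod as ℤ
open import Data.Integer using (ℤ; +_; -[1+_]; 0ℤ)
import Data.Integer.Properties as ℤP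
open import Data.Integer.Tactic.RingSolver renaming (solve-∀ to ℤ-solve-∀)
import Data.Nat as ℕ
open import Data.Nat using (suc)
open import Data.Nat.Coprimality as Cop using (Coprime; coprime-divisor)
open import Data.Nat.Divisibility using (_∣_; divides; ∣-trans)
open import Data.Nat.DivMod using (_%_; _/_; m≡m%n+[m/n]*n; m%n<n)
import Data.Nat.Properties as ℕP
open import Data.Nat.Tactic.RingSolver renaming (solve-∀ to ℕ-solve-∀)
open import Data.Product using (_,_; proj₁; proj₂)
open import Data.Vec using (Vec)
import Data.Rational as ℚ
open import Data.Rational using (ℚ; mkℚ; 0ℚ; 1ℚ; ½)
open import Data.Rational.Literals using (fromℤ)
import Data.Rational.Properties as ℚP
open import Algebra.Properties.Group ℚP.+-0-group using (inverseˡ-unique; x∙y⁻¹≈ε⇒x≈y; x≈y⇒x∙y⁻¹≈ε)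
import Data.Rational.Unnormalised.Properties as ℚᵘP
import Data.Rational.Unnormalised as ℚᵘ
open import Data.Sum using (_⊎_; inj₁; inj₂)
open import Function.Bundles using (mk⇔)
open import Level using (0ℓ)
open import Relation.Binary.PropositionalEquality using (refl; sym; trans; cong; cong₂; subst; subst₂; module ≡-Reasoning)
open import Relation.Nullary.Decidable.Core using (dec⇒maybe)
open import Tactic.RingSolver using (solve-∀)
open import Tactic.RingSolver.Core.AlmostCommutativeRing using (AlmostCommutativeRing; fromCommutativeRing)

open ≡-Reasoning

ℚ-ring : AlmostCommutativeRing 0ℓ 0ℓ
ℚ-ring = fromCommutativeRing ℚP.+-*-commutativeRing (λ x → dec⇒maybe (0ℚ ℚP.≟ x))

-- ℤ→ℚ i = i / 1 goes through gcd normalisation; fromℤ i is its normal form, on which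
-- the operations of ℚ compute.
ℤ→ℚ≡fromℤ : ∀ i → ℤ→ℚ i ≡ fromℤ i
ℤ→ℚ≡fromℤ i = ℚP.↥p/↧p≡p (fromℤ i)

ℤ→ℚ-homo-+ : ∀ i j → ℤ→ℚ (i ℤ.+ j) ≡ ℤ→ℚ i ℚ.+ ℤ→ℚ j
ℤ→ℚ-homo-+ i j = begin
  ℤ→ℚ (i ℤ.+ j)          ≡⟨ ℚP./-cong (sym (cong₂ ℤ._+_ (ℤP.*-identityʳ i) (ℤP.*-identityʳ j))) refl ⟩
  fromℤ i ℚ.+ fromℤ j     ≡⟨ sym (cong₂ ℚ._+_ (ℤ→ℚ≡fromℤ i) (ℤ→ℚ≡fromℤ j)) ⟩
  ℤ→ℚ i ℚ.+ ℤ→ℚ j        ∎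

ℤ→ℚ-homo-* : ∀ i j → ℤ→ℚ (i ℤ.* j) ≡ ℤ→ℚ i ℚ.* ℤ→ℚ j
ℤ→ℚ-homo-* i j = sym (cong₂ ℚ._*_ (ℤ→ℚ≡fromℤ i) (ℤ→ℚ≡fromℤ j))

ℤ→ℚ-homo-neg : ∀ i → ℤ→ℚ (ℤ.- i) ≡ ℚ.- ℤ→ℚ i
ℤ→ℚ-homo-neg i = inverseˡ-unique (ℤ→ℚ (ℤ.- i)) (ℤ→ℚ i) (begin
  ℤ→ℚ (ℤ.- i) ℚ.+ ℤ→ℚ i  ≡⟨ ℤ→ℚ-homo-+ (ℤ.- i) i ⟨
  ℤ→ℚ (ℤ.- i ℤ.+ i)       ≡⟨ cong ℤ→ℚ (ℤP.+-inverseˡ i) ⟩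
  0ℚ                       ∎)

ℕ→ℚ-homo-+ : ∀ m n → ℕ→ℚ (m ℕ.+ n) ≡ ℕ→ℚ m ℚ.+ ℕ→ℚ n
ℕ→ℚ-homo-+ m n = ℤ→ℚ-homo-+ (+ m) (+ n)

ℕ→ℚ-homo-* : ∀ m n → ℕ→ℚ (m * n) ≡ ℕ→ℚ m ℚ.* ℕ→ℚ n
ℕ→ℚ-homo-* m n = trans (cong ℤ→ℚ (ℤP.pos-* m n)) (ℤ→ℚ-homo-* (+ m) (+ n))

ℤ→ℚ-injective : ∀ {i j} → ℤ→ℚ i ≡ ℤ→ℚ j → i ≡ j
ℤ→ℚ-injective {i} {j} eq = cong ℚ.↥_ (trans (sym (ℤ→ℚ≡fromℤ i)) (trans eq (ℤ→ℚ≡fromℤ j)))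

ℕ→ℚ-nonNeg : ∀ n → ℚ.NonNegative (ℕ→ℚ n)
ℕ→ℚ-nonNeg n = ℚP.normalize-nonNeg n 1

ℤ→ℚ-nonNeg : ∀ {i} → 0ℤ ℤ.≤ i → ℚ.NonNegative (ℤ→ℚ i)
ℤ→ℚ-nonNeg {+ n} _ = ℕ→ℚ-nonNeg n

ℤ→ℚ-nonNeg⁻¹ : ∀ i → ℚ.NonNegative (ℤ→ℚ i) → 0ℤ ℤ.≤ i
ℤ→ℚ-nonNeg⁻¹ i nonNeg = ℤP.nonNegative⁻¹ i {{subst ℚ.NonNegative (ℤ→ℚ≡fromℤ i) nonNeg}}

ℕ→ℚ-inverse : ∀ n .{{_ : NonZero n}} → ∃[ x ] ℚ.NonNegative x × ℕ→ℚ n ℚ.* x ≡ 1ℚ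
ℕ→ℚ-inverse (suc n) =
  ℚ.1/ fromℤ (+ suc n) , _ ,
  trans (cong (ℚ._* ℚ.1/ fromℤ (+ suc n)) (ℤ→ℚ≡fromℤ (+ suc n))) (ℚP.*-inverseʳ (fromℤ (+ suc n)))

↥≡*↧ : ∀ r → ℤ→ℚ (ℚ.↥ r) ≡ r ℚ.* ℤ→ℚ (ℚ.↧ r)
↥≡*↧ r@(mkℚ n d-1 _) = begin
  ℤ→ℚ n                ≡⟨ ℤ→ℚ≡fromℤ n ⟩
  fromℤ n              ≡⟨ ℚP.toℚᵘ-injective (ℚᵘP.≃-sym (ℚᵘP.≃-trans (ℚP.toℚᵘ-homo-* r (fromℤ ↧r)) (ℚᵘ.*≡* cross))) ⟩
  r ℚ.* fromℤ ↧r       ≡⟨ cong (r ℚ.*_) (ℤ→ℚ≡fromℤ ↧r) ⟨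
  r ℚ.* ℤ→ℚ ↧r         ∎
  where
  ↧r : ℤ
  ↧r = + suc d-1
  cross : (n ℤ.* ↧r) ℤ.* + 1 ≡ n ℤ.* + suc (d-1 ℕ.* 1)
  cross rewrite ℕP.*-identityʳ d-1 = ℤP.*-identityʳ (n ℤ.* ↧r)

IsInt-+ : ∀ {r s} → IsInt r → IsInt s → IsInt (r ℚ.+ s)
IsInt-+ (i , refl) (j , refl) = i ℤ.+ j , sym (ℤ→ℚ-homo-+ i j)

IsInt-* : ∀ {r s} → IsInt r → IsInt s → IsInt (r ℚ.* s)
IsInt-* (i , refl) (j , refl) = i ℤ.* j , sym (ℤ→ℚ-homo-* i j)

IsInt-neg : ∀ {r} → IsInt r → IsInt (ℚ.- r)
IsInt-neg (i , refl) = ℤ.- i , sym (ℤ→ℚ-homo-neg i)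

IsInt-- : ∀ {r s} → IsInt r → IsInt s → IsInt (r - s)
IsInt-- r∈ℤ s∈ℤ = IsInt-+ r∈ℤ (IsInt-neg s∈ℤ)

Even : ℚ → Set
Even r = ∃[ k ] IsInt k × r ≡ k ℚ.+ k

Even-+ : ∀ {r s} → Even r → Even s → Even (r ℚ.+ s)
Even-+ (k , k∈ℤ , refl) (l , l∈ℤ , refl) = k ℚ.+ l , IsInt-+ k∈ℤ l∈ℤ , regroup k l
  where
  regroup : ∀ k l → k ℚ.+ k ℚ.+ (l ℚ.+ l) ≡ k ℚ.+ l ℚ.+ (k ℚ.+ l)
  regroup = solve-∀ ℚ-ring

Even-neg : ∀ {r} → Even r → Even (ℚ.- r)
Even-neg (k , k∈ℤ , refl) = ℚ.- k , IsInt-neg k∈ℤ , ℚP.neg-distrib-+ k k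

Even-*ˡ : ∀ {r s} → IsInt r → Even s → Even (r ℚ.* s)
Even-*ˡ {r} r∈ℤ (k , k∈ℤ , refl) = r ℚ.* k , IsInt-* r∈ℤ k∈ℤ , ℚP.*-distribˡ-+ r k k

Even⇒IsInt-half : ∀ {r} → Even r → IsInt (r ℚ.* ½)
Even⇒IsInt-half (k , k∈ℤ , refl) = subst IsInt (sym (halve k)) k∈ℤ
  where
  halve : ∀ k → (k ℚ.+ k) ℚ.* ½ ≡ k
  halve = solve-∀ ℚ-ring

ℤ-even∨odd : ∀ i → ∃[ k ] (i ≡ k ℤ.+ k ⊎ i ≡ k ℤ.+ k ℤ.+ ℤ.1ℤ)
ℤ-even∨odd i with i ℤ./ + 2 | i ℤ.% + 2 | ℤ.n%d<d i (+ 2) | ℤ.a≡a%n+[a/n]*n i (+ 2)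
... | k | 0 | _ | i≡2k   = k , inj₁ (trans i≡2k (double-even k))
  where
  double-even : ∀ k → + 0 ℤ.+ k ℤ.* + 2 ≡ k ℤ.+ k
  double-even = ℤ-solve-∀
... | k | 1 | _ | i≡2k+1 = k , inj₂ (trans i≡2k+1 (double-odd k))
  where
  double-odd : ∀ k → + 1 ℤ.+ k ℤ.* + 2 ≡ k ℤ.+ k ℤ.+ ℤ.1ℤ
  double-odd = ℤ-solve-∀
... | _ | suc (suc _) | ℕ.s≤s (ℕ.s≤s ()) | _

even∨odd : ∀ {r} → IsInt r → Even r ⊎ Even (r - 1ℚ)
even∨odd (i , refl) with ℤ-even∨odd i
... | k , inj₁ refl = inj₁ (ℤ→ℚ k , (k , refl) , ℤ→ℚ-homo-+ k k)
... | k , inj₂ refl = inj₂ (ℤ→ℚ k , (k , refl) , (begin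
  ℤ→ℚ (k ℤ.+ k ℤ.+ ℤ.1ℤ) - 1ℚ            ≡⟨ cong (_- 1ℚ) (ℤ→ℚ-homo-+ (k ℤ.+ k) ℤ.1ℤ) ⟩
  ℤ→ℚ (k ℤ.+ k) ℚ.+ 1ℚ - 1ℚ             ≡⟨ cong (λ x → x ℚ.+ 1ℚ - 1ℚ) (ℤ→ℚ-homo-+ k k) ⟩
  ℤ→ℚ k ℚ.+ ℤ→ℚ k ℚ.+ 1ℚ - 1ℚ          ≡⟨ cancel (ℤ→ℚ k) ⟩
  ℤ→ℚ k ℚ.+ ℤ→ℚ k                       ∎))
  where
  cancel : ∀ x → x ℚ.+ x ℚ.+ 1ℚ - 1ℚ ≡ x ℚ.+ x
  cancel = solve-∀ ℚ-ring

r*r-r-even : ∀ {r} → IsInt r → Even (r ℚ.* r - r)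
r*r-r-even {r} r∈ℤ with even∨odd r∈ℤ
... | inj₁ r-even   = subst Even (factorˡ r) (Even-*ˡ (IsInt-- r∈ℤ (ℤ.1ℤ , refl)) r-even)
  where
  factorˡ : ∀ r → (r - 1ℚ) ℚ.* r ≡ r ℚ.* r - r
  factorˡ = solve-∀ ℚ-ring
... | inj₂ r-1-even = subst Even (factorʳ r) (Even-*ˡ r∈ℤ r-1-even)
  where
  factorʳ : ∀ r → r ℚ.* (r - 1ℚ) ≡ r ℚ.* r - r
  factorʳ = solve-∀ ℚ-ring

-- P − DQ = (P² − DQ²) − (P² − P) + D(Q² − Q), and x² − x is even.
P²-DQ²-even⇒P-DQ-even : ∀ {D P Q} → IsInt D → IsInt P → IsInt Q →
                         Even (P ℚ.* P - D ℚ.* (Q ℚ.* Q)) → Even (P - D ℚ.* Q)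
P²-DQ²-even⇒P-DQ-even {D} {P} {Q} D∈ℤ P∈ℤ Q∈ℤ P²-DQ²-even =
  subst Even (regroup D P Q)
    (Even-+ (Even-+ P²-DQ²-even (Even-neg (r*r-r-even P∈ℤ))) (Even-*ˡ D∈ℤ (r*r-r-even Q∈ℤ)))
  where
  regroup : ∀ D P Q → (P ℚ.* P - D ℚ.* (Q ℚ.* Q)) ℚ.+ ℚ.- (P ℚ.* P - P) ℚ.+ D ℚ.* (Q ℚ.* Q - Q) ≡ P - D ℚ.* Q
  regroup = solve-∀ ℚ-ring

cross-term-even : ∀ {D P Q P′ Q′} → IsInt D → IsInt P → IsInt Q → IsInt P′ → IsInt Q′ →
                  Even (P ℚ.* P - D ℚ.* (Q ℚ.* Q)) → Even (P′ ℚ.* P′ - D ℚ.* (Q′ ℚ.* Q′)) →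
                  Even (P ℚ.* P′ - D ℚ.* (Q ℚ.* Q′))
cross-term-even {D} {P} {Q} {P′} {Q′} D∈ℤ P∈ℤ Q∈ℤ P′∈ℤ Q′∈ℤ even even′ =
  subst Even (regroup D P Q P′ Q′)
    (Even-+ (Even-+ (Even-+ (Even-*ˡ (IsInt-- P∈ℤ (IsInt-* D∈ℤ Q∈ℤ)) δ′-even)
                            (Even-*ˡ (IsInt-* D∈ℤ Q∈ℤ) δ′-even))
                    (Even-*ˡ (IsInt-* D∈ℤ Q′∈ℤ) δ-even))
            (Even-*ˡ (IsInt-* Q∈ℤ Q′∈ℤ) (r*r-r-even D∈ℤ)))
  where
  δ-even : Even (P - D ℚ.* Q)
  δ-even  = P²-DQ²-even⇒P-DQ-even D∈ℤ P∈ℤ Q∈ℤ even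
  δ′-even : Even (P′ - D ℚ.* Q′)
  δ′-even = P²-DQ²-even⇒P-DQ-even D∈ℤ P′∈ℤ Q′∈ℤ even′
  regroup : ∀ D P Q P′ Q′ →
    (P - D ℚ.* Q) ℚ.* (P′ - D ℚ.* Q′) ℚ.+ (D ℚ.* Q) ℚ.* (P′ - D ℚ.* Q′) ℚ.+ (D ℚ.* Q′) ℚ.* (P - D ℚ.* Q)
      ℚ.+ (Q ℚ.* Q′) ℚ.* (D ℚ.* D - D)
    ≡ P ℚ.* P′ - D ℚ.* (Q ℚ.* Q′)
  regroup = solve-∀ ℚ-ring

coprime-*ʳ : ∀ {m n k} → Coprime m n → Coprime m k → Coprime m (n * k)
coprime-*ʳ {n = n} m⊥n m⊥k {i} (i∣m , i∣nk) = m⊥k (i∣m , coprime-divisor i⊥n i∣nk)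
  where
  i⊥n : Coprime i n
  i⊥n (j∣i , j∣n) = m⊥n (∣-trans j∣i i∣m , j∣n)

coprime-squares : ∀ {m n} → Coprime m n → Coprime (m * m) (n * n)
coprime-squares {m} {n} m⊥n = Cop.sym (coprime-*ʳ n²⊥m n²⊥m)
  where
  n²⊥m : Coprime (n * n) m
  n²⊥m = Cop.sym (coprime-*ʳ m⊥n m⊥n)

denominator≡1⇒IsInt : ∀ r → ℚ.↧ₙ r ≡ 1 → IsInt r
denominator≡1⇒IsInt (mkℚ n 0 _) refl = n , sym (ℤ→ℚ≡fromℤ n)

squarefree-*-square⇒IsInt : ∀ {d r} → SquareFree d → IsInt (ℕ→ℚ d ℚ.* (r ℚ.* r)) → IsInt r
squarefree-*-square⇒IsInt {d} {r@(mkℚ n k-1 n⊥k)} squarefree (z , dr²≡z) =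
  denominator≡1⇒IsInt r (squarefree k k²∣d)
  where
  k : ℕ
  k = suc k-1
  k̂ : ℚ
  k̂ = ℤ→ℚ (+ k)
  cleared : + d ℤ.* (n ℤ.* n) ≡ z ℤ.* (+ k ℤ.* + k)
  cleared = ℤ→ℚ-injective (begin
    ℤ→ℚ (+ d ℤ.* (n ℤ.* n))                  ≡⟨ ℤ→ℚ-homo-*³ (+ d) n n ⟩
    ℕ→ℚ d ℚ.* (ℤ→ℚ n ℚ.* ℤ→ℚ n)              ≡⟨ cong (λ x → ℕ→ℚ d ℚ.* (x ℚ.* x)) (↥≡*↧ r) ⟩
    ℕ→ℚ d ℚ.* ((r ℚ.* k̂) ℚ.* (r ℚ.* k̂))      ≡⟨ regroup (ℕ→ℚ d) r k̂ ⟩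
    (ℕ→ℚ d ℚ.* (r ℚ.* r)) ℚ.* (k̂ ℚ.* k̂)      ≡⟨ cong (ℚ._* (k̂ ℚ.* k̂)) dr²≡z ⟩
    ℤ→ℚ z ℚ.* (k̂ ℚ.* k̂)                       ≡⟨ ℤ→ℚ-homo-*³ z (+ k) (+ k) ⟨
    ℤ→ℚ (z ℤ.* (+ k ℤ.* + k))                 ∎)
    where
    regroup : ∀ D r K → D ℚ.* ((r ℚ.* K) ℚ.* (r ℚ.* K)) ≡ (D ℚ.* (r ℚ.* r)) ℚ.* (K ℚ.* K)
    regroup = solve-∀ ℚ-ring
    ℤ→ℚ-homo-*³ : ∀ i j l → ℤ→ℚ (i ℤ.* (j ℤ.* l)) ≡ ℤ→ℚ i ℚ.* (ℤ→ℚ j ℚ.* ℤ→ℚ l)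
    ℤ→ℚ-homo-*³ i j l = trans (ℤ→ℚ-homo-* i (j ℤ.* l)) (cong (ℤ→ℚ i ℚ.*_) (ℤ→ℚ-homo-* j l))
  ∣cleared∣ : ℤ.∣ n ∣ * ℤ.∣ n ∣ * d ≡ ℤ.∣ z ∣ * (k * k)
  ∣cleared∣ = begin
    ℤ.∣ n ∣ * ℤ.∣ n ∣ * d               ≡⟨ ℕP.*-comm (ℤ.∣ n ∣ * ℤ.∣ n ∣) d ⟩
    d * (ℤ.∣ n ∣ * ℤ.∣ n ∣)             ≡⟨ cong (d *_) (ℤP.abs-* n n) ⟨
    d * ℤ.∣ n ℤ.* n ∣                   ≡⟨ ℤP.abs-* (+ d) (n ℤ.* n) ⟨
    ℤ.∣ + d ℤ.* (n ℤ.* n) ∣             ≡⟨ cong ℤ.∣_∣ cleared ⟩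
    ℤ.∣ z ℤ.* (+ k ℤ.* + k) ∣           ≡⟨ ℤP.abs-* z (+ k ℤ.* + k) ⟩
    ℤ.∣ z ∣ * ℤ.∣ + k ℤ.* + k ∣         ≡⟨ cong (ℤ.∣ z ∣ *_) (ℤP.abs-* (+ k) (+ k)) ⟩
    ℤ.∣ z ∣ * (k * k)                   ∎
  k²∣d : k * k ∣ d
  k²∣d = coprime-divisor (coprime-squares (Cop.sym (Cop.recompute n⊥k))) (divides ℤ.∣ z ∣ ∣cleared∣)

InO⇒doubles : ∀ {d p q} → SquareFree d → InO d (p , q) →
              IsInt (p ℚ.+ p) × IsInt (q ℚ.+ q)
              × Even ((p ℚ.+ p) ℚ.* (p ℚ.+ p) - ℕ→ℚ d ℚ.* ((q ℚ.+ q) ℚ.* (q ℚ.+ q)))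
InO⇒doubles {d} {p} {q} squarefree (2p∈ℤ , N∈ℤ) =
  2p∈ℤ , 2q∈ℤ , (N ℚ.+ N , IsInt-+ N∈ℤ N∈ℤ , quadruple (ℕ→ℚ d) p q)
  where
  N : ℚ
  N = p ℚ.* p - ℕ→ℚ d ℚ.* (q ℚ.* q)
  quadruple : ∀ D p q → let N = p ℚ.* p - D ℚ.* (q ℚ.* q) in
    (p ℚ.+ p) ℚ.* (p ℚ.+ p) - D ℚ.* ((q ℚ.+ q) ℚ.* (q ℚ.+ q)) ≡ N ℚ.+ N ℚ.+ (N ℚ.+ N)
  quadruple = solve-∀ ℚ-ring
  rearrange : ∀ D p q → let N = p ℚ.* p - D ℚ.* (q ℚ.* q) in
    (p ℚ.+ p) ℚ.* (p ℚ.+ p) - (N ℚ.+ N ℚ.+ (N ℚ.+ N)) ≡ D ℚ.* ((q ℚ.+ q) ℚ.* (q ℚ.+ q))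
  rearrange = solve-∀ ℚ-ring
  2q∈ℤ : IsInt (q ℚ.+ q)
  2q∈ℤ = squarefree-*-square⇒IsInt squarefree
    (subst IsInt (rearrange (ℕ→ℚ d) p q)
      (IsInt-- (IsInt-* 2p∈ℤ 2p∈ℤ) (IsInt-+ (IsInt-+ N∈ℤ N∈ℤ) (IsInt-+ N∈ℤ N∈ℤ))))

InO-⊕ : ∀ {d x y} → SquareFree d → InO d x → InO d y → InO d (x ⊕ y)
InO-⊕ {d} {p , q} {p′ , q′} squarefree x∈O@(_ , N∈ℤ) y∈O@(_ , N′∈ℤ) =
  let 2p∈ℤ , 2q∈ℤ , 4N-even = InO⇒doubles {d} {p} {q} squarefree x∈O
      2p′∈ℤ , 2q′∈ℤ , 4N′-even = InO⇒doubles {d} {p′} {q′} squarefree y∈O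
  in
  subst IsInt (trace-⊕ p p′) (IsInt-+ 2p∈ℤ 2p′∈ℤ) ,
  subst IsInt (norm-⊕ (ℕ→ℚ d) p q p′ q′)
    (IsInt-+ (IsInt-+ N∈ℤ N′∈ℤ)
             (Even⇒IsInt-half (cross-term-even (+ d , refl) 2p∈ℤ 2q∈ℤ 2p′∈ℤ 2q′∈ℤ 4N-even 4N′-even)))
  where
  trace-⊕ : ∀ p p′ → (p ℚ.+ p) ℚ.+ (p′ ℚ.+ p′) ≡ (p ℚ.+ p′) ℚ.+ (p ℚ.+ p′)
  trace-⊕ = solve-∀ ℚ-ring
  norm-⊕ : ∀ D p q p′ q′ →
    (p ℚ.* p - D ℚ.* (q ℚ.* q)) ℚ.+ (p′ ℚ.* p′ - D ℚ.* (q′ ℚ.* q′))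
      ℚ.+ ((p ℚ.+ p) ℚ.* (p′ ℚ.+ p′) - D ℚ.* ((q ℚ.+ q) ℚ.* (q′ ℚ.+ q′))) ℚ.* ½
    ≡ (p ℚ.+ p′) ℚ.* (p ℚ.+ p′) - D ℚ.* ((q ℚ.+ q′) ℚ.* (q ℚ.+ q′))
  norm-⊕ = solve-∀ ℚ-ring

InO-· : ∀ {d r x} → IsInt r → InO d x → InO d (r · x)
InO-· {d} {r} {p , q} r∈ℤ (2p∈ℤ , N∈ℤ) =
  subst IsInt (ℚP.*-distribˡ-+ r p p) (IsInt-* r∈ℤ 2p∈ℤ) ,
  subst IsInt (norm-· (ℕ→ℚ d) r p q) (IsInt-* (IsInt-* r∈ℤ r∈ℤ) N∈ℤ)
  where
  norm-· : ∀ D r p q → (r ℚ.* r) ℚ.* (p ℚ.* p - D ℚ.* (q ℚ.* q)) ≡ (r ℚ.* p) ℚ.* (r ℚ.* p) - D ℚ.* ((r ℚ.* q) ℚ.* (r ℚ.* q))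
  norm-· = solve-∀ ℚ-ring

module Coordinates (β₁ β₂ : K) where

  ⟪_,_⟫ : ℚ → ℚ → K
  ⟪ r , s ⟫ = r · β₁ ⊕ s · β₂

  ⟦_,_⟧ : ℤ → ℤ → K
  ⟦ m , n ⟧ = ⟪ ℤ→ℚ m , ℤ→ℚ n ⟫

  ⟪⟫-⊕ : ∀ r s r′ s′ → ⟪ r , s ⟫ ⊕ ⟪ r′ , s′ ⟫ ≡ ⟪ r ℚ.+ r′ , s ℚ.+ s′ ⟫
  ⟪⟫-⊕ r s r′ s′ = cong₂ _,_ (regroup r s r′ s′ (proj₁ β₁) (proj₁ β₂)) (regroup r s r′ s′ (proj₂ β₁) (proj₂ β₂))
    where
    regroup : ∀ r s r′ s′ x y → (r ℚ.* x ℚ.+ s ℚ.* y) ℚ.+ (r′ ℚ.* x ℚ.+ s′ ℚ.* y) ≡ (r ℚ.+ r′) ℚ.* x ℚ.+ (s ℚ.+ s′) ℚ.* y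
    regroup = solve-∀ ℚ-ring

  ⟦⟧-⊕ : ∀ m n m′ n′ → ⟦ m , n ⟧ ⊕ ⟦ m′ , n′ ⟧ ≡ ⟦ m ℤ.+ m′ , n ℤ.+ n′ ⟧
  ⟦⟧-⊕ m n m′ n′ = trans (⟪⟫-⊕ (ℤ→ℚ m) (ℤ→ℚ n) (ℤ→ℚ m′) (ℤ→ℚ n′))
                         (sym (cong₂ ⟪_,_⟫ (ℤ→ℚ-homo-+ m m′) (ℤ→ℚ-homo-+ n n′)))

  ·β₁-⊕-⟪⟫ : ∀ t r s → t · β₁ ⊕ ⟪ r , s ⟫ ≡ ⟪ t ℚ.+ r , s ⟫
  ·β₁-⊕-⟪⟫ t r s = cong₂ _,_ (regroup t r s (proj₁ β₁) (proj₁ β₂)) (regroup t r s (proj₂ β₁) (proj₂ β₂))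
    where
    regroup : ∀ t r s x y → t ℚ.* x ℚ.+ (r ℚ.* x ℚ.+ s ℚ.* y) ≡ (t ℚ.+ r) ℚ.* x ℚ.+ s ℚ.* y
    regroup = solve-∀ ℚ-ring

  ·-⟪⟫ : ∀ c r s → c · ⟪ r , s ⟫ ≡ ⟪ c ℚ.* r , c ℚ.* s ⟫
  ·-⟪⟫ c r s = cong₂ _,_ (regroup c r s (proj₁ β₁) (proj₁ β₂)) (regroup c r s (proj₂ β₁) (proj₂ β₂))
    where
    regroup : ∀ c r s x y → c ℚ.* (r ℚ.* x ℚ.+ s ℚ.* y) ≡ (c ℚ.* r) ℚ.* x ℚ.+ (c ℚ.* s) ℚ.* y
    regroup = solve-∀ ℚ-ring

  ·β₁-⊕-⟦⟧ : ∀ k m n → ℤ→ℚ k · β₁ ⊕ ⟦ m , n ⟧ ≡ ⟦ k ℤ.+ m , n ⟧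
  ·β₁-⊕-⟦⟧ k m n = trans (·β₁-⊕-⟪⟫ (ℤ→ℚ k) (ℤ→ℚ m) (ℤ→ℚ n)) (cong ⟪_, ℤ→ℚ n ⟫ (sym (ℤ→ℚ-homo-+ k m)))

  lincomb-⟪⟫ : ∀ u v x₁ x₂ x₃ →
    lincomb (x₁ ∷ x₂ ∷ x₃ ∷ []) (β₁ ∷ β₂ ∷ v · β₂ ⊕ u · β₁ ∷ []) ≡ ⟪ x₁ ℚ.+ x₃ ℚ.* u , x₂ ℚ.+ x₃ ℚ.* v ⟫
  lincomb-⟪⟫ u v x₁ x₂ x₃ =
    cong₂ _,_ (regroup u v x₁ x₂ x₃ (proj₁ β₁) (proj₁ β₂)) (regroup u v x₁ x₂ x₃ (proj₂ β₁) (proj₂ β₂))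
    where
    regroup : ∀ u v x₁ x₂ x₃ x y →
      x₁ ℚ.* x ℚ.+ (x₂ ℚ.* y ℚ.+ (x₃ ℚ.* (v ℚ.* y ℚ.+ u ℚ.* x) ℚ.+ 0ℚ))
        ≡ (x₁ ℚ.+ x₃ ℚ.* u) ℚ.* x ℚ.+ (x₂ ℚ.+ x₃ ℚ.* v) ℚ.* y
    regroup = solve-∀ ℚ-ring

  module Independent (independent : ∀ m n → ⟦ m , n ⟧ ≡ 0K → (m ≡ 0ℤ) × (n ≡ 0ℤ)) where

    -- Clearing denominators turns a rational relation into an integral one.
    ⟪⟫≡0K⇒≡0 : ∀ r s → ⟪ r , s ⟫ ≡ 0K → r ≡ 0ℚ × s ≡ 0ℚ
    ⟪⟫≡0K⇒≡0 r s rs≡0 =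
      let ↥r↧s≡0 , ↥s↧r≡0 = independent (ℚ.↥ r ℤ.* ℚ.↧ s) (ℚ.↥ s ℤ.* ℚ.↧ r) cleared≡0
      in ↥*↧≡0⇒≡0 r s ↥r↧s≡0 , ↥*↧≡0⇒≡0 s r ↥s↧r≡0
      where
      ↥*↧≡0⇒≡0 : ∀ r s → ℚ.↥ r ℤ.* ℚ.↧ s ≡ 0ℤ → r ≡ 0ℚ
      ↥*↧≡0⇒≡0 r s eq with ℤP.i*j≡0⇒i≡0∨j≡0 (ℚ.↥ r) eq
      ... | inj₁ ↥r≡0 = ℚP.↥p≡0⇒p≡0 r ↥r≡0
      ... | inj₂ ()
      ↥*↧≡↧*↧* : ∀ r s → ℤ→ℚ (ℚ.↥ r ℤ.* ℚ.↧ s) ≡ ℤ→ℚ (ℚ.↧ r ℤ.* ℚ.↧ s) ℚ.* r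
      ↥*↧≡↧*↧* r s = begin
        ℤ→ℚ (ℚ.↥ r ℤ.* ℚ.↧ s)                    ≡⟨ ℤ→ℚ-homo-* (ℚ.↥ r) (ℚ.↧ s) ⟩
        ℤ→ℚ (ℚ.↥ r) ℚ.* ℤ→ℚ (ℚ.↧ s)              ≡⟨ cong (ℚ._* ℤ→ℚ (ℚ.↧ s)) (↥≡*↧ r) ⟩
        r ℚ.* ℤ→ℚ (ℚ.↧ r) ℚ.* ℤ→ℚ (ℚ.↧ s)        ≡⟨ rotate r (ℤ→ℚ (ℚ.↧ r)) (ℤ→ℚ (ℚ.↧ s)) ⟩
        ℤ→ℚ (ℚ.↧ r) ℚ.* ℤ→ℚ (ℚ.↧ s) ℚ.* r        ≡⟨ cong (ℚ._* r) (ℤ→ℚ-homo-* (ℚ.↧ r) (ℚ.↧ s)) ⟨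
        ℤ→ℚ (ℚ.↧ r ℤ.* ℚ.↧ s) ℚ.* r              ∎
        where
        rotate : ∀ x y z → x ℚ.* y ℚ.* z ≡ y ℚ.* z ℚ.* x
        rotate = solve-∀ ℚ-ring
      c : ℚ
      c = ℤ→ℚ (ℚ.↧ r ℤ.* ℚ.↧ s)
      cleared≡0 : ⟦ ℚ.↥ r ℤ.* ℚ.↧ s , ℚ.↥ s ℤ.* ℚ.↧ r ⟧ ≡ 0K
      cleared≡0 = begin
        ⟦ ℚ.↥ r ℤ.* ℚ.↧ s , ℚ.↥ s ℤ.* ℚ.↧ r ⟧   ≡⟨ cong₂ ⟪_,_⟫ (↥*↧≡↧*↧* r s) (trans (↥*↧≡↧*↧* s r) (cong (λ x → ℤ→ℚ x ℚ.* s) (ℤP.*-comm (ℚ.↧ s) (ℚ.↧ r)))) ⟩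
        ⟪ c ℚ.* r , c ℚ.* s ⟫                   ≡⟨ ·-⟪⟫ c r s ⟨
        c · ⟪ r , s ⟫                            ≡⟨ cong (c ·_) rs≡0 ⟩
        c · 0K                                   ≡⟨ cong₂ _,_ (ℚP.*-zeroʳ c) (ℚP.*-zeroʳ c) ⟩
        0K                                       ∎

    ⟪⟫-injective : ∀ {r s r′ s′} → ⟪ r , s ⟫ ≡ ⟪ r′ , s′ ⟫ → r ≡ r′ × s ≡ s′
    ⟪⟫-injective {r} {s} {r′} {s′} eq =
      let r-r′≡0 , s-s′≡0 = ⟪⟫≡0K⇒≡0 (r - r′) (s - s′) difference≡0
      in x∙y⁻¹≈ε⇒x≈y r r′ r-r′≡0 , x∙y⁻¹≈ε⇒x≈y s s′ s-s′≡0
      where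
      regroup : ∀ r s r′ s′ x y → (r - r′) ℚ.* x ℚ.+ (s - s′) ℚ.* y ≡ (r ℚ.* x ℚ.+ s ℚ.* y) - (r′ ℚ.* x ℚ.+ s′ ℚ.* y)
      regroup = solve-∀ ℚ-ring
      difference≡0 : ⟪ r - r′ , s - s′ ⟫ ≡ 0K
      difference≡0 = cong₂ _,_
        (trans (regroup r s r′ s′ (proj₁ β₁) (proj₁ β₂)) (x≈y⇒x∙y⁻¹≈ε (cong proj₁ eq)))
        (trans (regroup r s r′ s′ (proj₂ β₁) (proj₂ β₂)) (x≈y⇒x∙y⁻¹≈ε (cong proj₂ eq)))

    ⟦⟧-injective : ∀ {m n m′ n′} → ⟦ m , n ⟧ ≡ ⟦ m′ , n′ ⟧ → m ≡ m′ × n ≡ n′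
    ⟦⟧-injective {m} {n} eq =
      let m̂≡m̂′ , n̂≡n̂′ = ⟪⟫-injective {ℤ→ℚ m} {ℤ→ℚ n} eq
      in ℤ→ℚ-injective m̂≡m̂′ , ℤ→ℚ-injective n̂≡n̂′

m+p≡o+n⇒m-n≡o-p : ∀ {m n o p} → m ℕ.+ p ≡ o ℕ.+ n → + m ℤ.- + n ≡ + o ℤ.- + p
m+p≡o+n⇒m-n≡o-p {m} {n} {o} {p} eq = begin
  + m ℤ.- + n                          ≡⟨ extend (+ m) (+ n) (+ p) ⟩
  (+ m ℤ.+ + p) ℤ.- (+ n ℤ.+ + p)      ≡⟨ cong (λ x → + x ℤ.- (+ n ℤ.+ + p)) eq ⟩
  (+ o ℤ.+ + n) ℤ.- (+ n ℤ.+ + p)      ≡⟨ cancel (+ o) (+ n) (+ p) ⟩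
  + o ℤ.- + p                          ∎
  where
  extend : ∀ m n p → m ℤ.- n ≡ (m ℤ.+ p) ℤ.- (n ℤ.+ p)
  extend = ℤ-solve-∀
  cancel : ∀ o n p → (o ℤ.+ n) ℤ.- (n ℤ.+ p) ≡ o ℤ.- p
  cancel = ℤ-solve-∀

m-n≡o-p⇒m+p≡o+n : ∀ {m n o p} → + m ℤ.- + n ≡ + o ℤ.- + p → m ℕ.+ p ≡ o ℕ.+ n
m-n≡o-p⇒m+p≡o+n {m} {n} {o} {p} eq = ℤP.+-injective (begin
  + m ℤ.+ + p                          ≡⟨ extend (+ m) (+ n) (+ p) ⟩
  (+ m ℤ.- + n) ℤ.+ (+ n ℤ.+ + p)      ≡⟨ cong (ℤ._+ (+ n ℤ.+ + p)) eq ⟩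
  (+ o ℤ.- + p) ℤ.+ (+ n ℤ.+ + p)      ≡⟨ cancel (+ o) (+ n) (+ p) ⟩
  + o ℤ.+ + n                          ∎)
  where
  extend : ∀ m n p → m ℤ.+ p ≡ (m ℤ.- n) ℤ.+ (n ℤ.+ p)
  extend = ℤ-solve-∀
  cancel : ∀ o n p → (o ℤ.- p) ℤ.+ (n ℤ.+ p) ≡ o ℤ.+ n
  cancel = ℤ-solve-∀

module IntegerModel (a b : ℕ) .{{_ : NonZero a}} where

  -- (m, n) stands for mβ₁ + nβ₂: InSG describes y₁β₁ + y₂β₂ + y₃α with α = −aβ₁ + abβ₂,
  -- and InCone the integer points of C_ℚ(β₁, β₂, α).

  InSG : ℤ → ℤ → Set
  InSG m n = ∃[ y₁ ] ∃[ y₂ ] ∃[ y₃ ] m ≡ + y₁ ℤ.- + (a * y₃) × n ≡ + (y₂ ℕ.+ a * b * y₃)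

  InCone : ℤ → ℤ → Set
  InCone m n = 0ℤ ℤ.≤ n × 0ℤ ℤ.≤ + b ℤ.* m ℤ.+ n

  InCone-+ : ∀ {m n m′ n′} → InCone m n → InCone m′ n′ → InCone (m ℤ.+ m′) (n ℤ.+ n′)
  InCone-+ {m} {n} {m′} {n′} (0≤n , 0≤bm+n) (0≤n′ , 0≤bm′+n′) =
    ℤP.+-mono-≤ 0≤n 0≤n′ ,
    subst (0ℤ ℤ.≤_) (regroup (+ b) m n m′ n′) (ℤP.+-mono-≤ 0≤bm+n 0≤bm′+n′)
    where
    regroup : ∀ b m n m′ n′ → (b ℤ.* m ℤ.+ n) ℤ.+ (b ℤ.* m′ ℤ.+ n′) ≡ b ℤ.* (m ℤ.+ m′) ℤ.+ (n ℤ.+ n′)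
    regroup = ℤ-solve-∀

  InCone-−k,bk : ∀ k → InCone (ℤ.- + k) (+ (b * k))
  InCone-−k,bk k = ℤ.+≤+ ℕ.z≤n , ℤP.≤-reflexive (sym (begin
    + b ℤ.* ℤ.- + k ℤ.+ + (b * k)       ≡⟨ cong (λ x → + b ℤ.* ℤ.- + k ℤ.+ x) (ℤP.pos-* b k) ⟩
    + b ℤ.* ℤ.- + k ℤ.+ + b ℤ.* + k     ≡⟨ cancel (+ b) (+ k) ⟩
    0ℤ                                   ∎))
    where
    cancel : ∀ b k → b ℤ.* ℤ.- k ℤ.+ b ℤ.* k ≡ 0ℤ
    cancel = ℤ-solve-∀

  -- With k = ρ + qa and ρ < a: (a − 1) − k = (a − 1 − ρ) − aq.
  b*k≤t⇒InSG-shift : ∀ k t → b * k ℕ.≤ t → InSG (+ (a ∸ 1) ℤ.- + k) (+ t)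
  b*k≤t⇒InSG-shift k t bk≤t =
    a ∸ 1 ∸ ρ , t ∸ a * b * q , q , m+p≡o+n⇒m-n≡o-p {a ∸ 1} {k} first-coordinate , cong +_ (sym (ℕP.m∸n+n≡m abq≤t))
    where
    ρ q : ℕ
    ρ = k % a
    q = k / a
    k≡ρ+qa : k ≡ ρ ℕ.+ q * a
    k≡ρ+qa = m≡m%n+[m/n]*n k a
    ρ≤a∸1 : ρ ℕ.≤ a ∸ 1
    ρ≤a∸1 = ℕP.<⇒≤pred (m%n<n k a)
    first-coordinate : a ∸ 1 ℕ.+ a * q ≡ a ∸ 1 ∸ ρ ℕ.+ k
    first-coordinate = begin
      a ∸ 1 ℕ.+ a * q                  ≡⟨ cong (ℕ._+ a * q) (ℕP.m∸n+n≡m ρ≤a∸1) ⟨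
      a ∸ 1 ∸ ρ ℕ.+ ρ ℕ.+ a * q        ≡⟨ regroup (a ∸ 1 ∸ ρ) ρ a q ⟩
      a ∸ 1 ∸ ρ ℕ.+ (ρ ℕ.+ q * a)      ≡⟨ cong (a ∸ 1 ∸ ρ ℕ.+_) k≡ρ+qa ⟨
      a ∸ 1 ∸ ρ ℕ.+ k                  ∎
      where
      regroup : ∀ x ρ a q → x ℕ.+ ρ ℕ.+ a * q ≡ x ℕ.+ (ρ ℕ.+ q * a)
      regroup = ℕ-solve-∀
    abq≤t : a * b * q ℕ.≤ t
    abq≤t = ℕP.≤-trans (ℕP.≤-reflexive (regroup a b q))
              (ℕP.≤-trans (ℕP.*-monoʳ-≤ b (subst (q * a ℕ.≤_) (sym k≡ρ+qa) (ℕP.m≤n+m (q * a) ρ))) bk≤t)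
      where
      regroup : ∀ a b q → a * b * q ≡ b * (q * a)
      regroup = ℕ-solve-∀

  0≤b*-[1+k]+t⇒b*[1+k]≤t : ∀ k t → 0ℤ ℤ.≤ + b ℤ.* -[1+ k ] ℤ.+ + t → b * suc k ℕ.≤ t
  0≤b*-[1+k]+t⇒b*[1+k]≤t k t 0≤ = ℤP.drop‿+≤+ (ℤP.0≤i-j⇒j≤i (subst (0ℤ ℤ.≤_) (begin
    + b ℤ.* ℤ.- + suc k ℤ.+ + t       ≡⟨ cong (ℤ._+ + t) (ℤP.neg-distribʳ-* (+ b) (+ suc k)) ⟨
    ℤ.- (+ b ℤ.* + suc k) ℤ.+ + t     ≡⟨ cong (λ x → ℤ.- x ℤ.+ + t) (ℤP.pos-* b (suc k)) ⟨
    ℤ.- + (b * suc k) ℤ.+ + t         ≡⟨ ℤP.+-comm (ℤ.- + (b * suc k)) (+ t) ⟩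
    + t ℤ.- + (b * suc k)             ∎) 0≤))

  InCone⇒InSG-shift : ∀ {m n} → InCone m n → InSG (+ (a ∸ 1) ℤ.+ m) n
  InCone⇒InSG-shift {+ r} {+ t} _ = a ∸ 1 ℕ.+ r , t , 0 , first-coordinate , cong +_ (sym second-coordinate)
    where
    first-coordinate : + (a ∸ 1 ℕ.+ r) ≡ + (a ∸ 1 ℕ.+ r) ℤ.- + (a * 0)
    first-coordinate = sym (trans (cong (λ x → + (a ∸ 1 ℕ.+ r) ℤ.- + x) (ℕP.*-zeroʳ a)) (ℤP.+-identityʳ _))
    second-coordinate : t ℕ.+ a * b * 0 ≡ t
    second-coordinate = trans (cong (t ℕ.+_) (ℕP.*-zeroʳ (a * b))) (ℕP.+-identityʳ t)
  InCone⇒InSG-shift { -[1+ k ]} {+ t} (_ , 0≤) = b*k≤t⇒InSG-shift (suc k) t (0≤b*-[1+k]+t⇒b*[1+k]≤t k t 0≤)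

  -- The shifted point has first coordinate −1 − a·y₃, so it needs z₃ > y₃ copies of α.
  shifted-InSG⇒ab≤y₂+b[1+y₁] : ∀ y₁ y₂ y₃ →
    InSG (+ y₁ ℤ.- + (a * y₃) ℤ.- + suc y₁) (+ (y₂ ℕ.+ a * b * y₃) ℤ.+ + (b * suc y₁)) →
    a * b ℕ.≤ y₂ ℕ.+ b * suc y₁
  shifted-InSG⇒ab≤y₂+b[1+y₁] y₁ y₂ y₃ (z₁ , z₂ , z₃ , first , second) =
    ℕP.+-cancelˡ-≤ (a * b * y₃) (a * b) (y₂ ℕ.+ b * suc y₁)
      (ℕP.≤-trans (ℕP.≤-reflexive (expand (a * b) y₃))
      (ℕP.≤-trans (ℕP.*-monoʳ-≤ (a * b) y₃<z₃)
      (ℕP.≤-trans (ℕP.m≤n+m (a * b * z₃) z₂)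
                  (ℕP.≤-reflexive (trans (sym second′) (regroup y₂ (a * b * y₃) (b * suc y₁)))))))
    where
    drop : ∀ y₁ A → y₁ ℤ.- A ℤ.- (ℤ.1ℤ ℤ.+ y₁) ≡ 0ℤ ℤ.- (ℤ.1ℤ ℤ.+ A)
    drop = ℤ-solve-∀
    first′ : 0 ℕ.+ a * z₃ ≡ z₁ ℕ.+ suc (a * y₃)
    first′ = m-n≡o-p⇒m+p≡o+n {0} {suc (a * y₃)} (trans (sym (drop (+ y₁) (+ (a * y₃)))) first)
    y₃<z₃ : y₃ ℕ.< z₃
    y₃<z₃ = ℕP.*-cancelˡ-< a y₃ z₃ (subst (suc (a * y₃) ℕ.≤_) (sym first′) (ℕP.m≤n+m (suc (a * y₃)) z₁))
    second′ : y₂ ℕ.+ a * b * y₃ ℕ.+ b * suc y₁ ≡ z₂ ℕ.+ a * b * z₃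
    second′ = ℤP.+-injective second
    expand : ∀ c y → c * y ℕ.+ c ≡ c * suc y
    expand = ℕ-solve-∀
    regroup : ∀ x y z → x ℕ.+ y ℕ.+ z ≡ y ℕ.+ (x ℕ.+ z)
    regroup = ℕ-solve-∀

  frobenius-bound : ∀ {m n} → InSG m n → (∀ k → InSG (m ℤ.- + k) (n ℤ.+ + (b * k))) → InCone (m ℤ.- + (a ∸ 1)) n
  frobenius-bound (y₁ , y₂ , y₃ , refl , refl) shifts∈SG =
    ℤ.+≤+ ℕ.z≤n ,
    subst (0ℤ ℤ.≤_) (sym (subst (λ x → lhs x ≡ rhs x) (ℕP.suc-pred a) (lhs≡rhs (a ∸ 1))))
      (ℤP.i≤j⇒0≤j-i (ℤ.+≤+ (shifted-InSG⇒ab≤y₂+b[1+y₁] y₁ y₂ y₃ (shifts∈SG (suc y₁)))))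
    where
    lhs rhs : ℕ → ℤ
    lhs x = + b ℤ.* (+ y₁ ℤ.- + (x * y₃) ℤ.- + (x ∸ 1)) ℤ.+ + (y₂ ℕ.+ x * b * y₃)
    rhs x = + (y₂ ℕ.+ b * suc y₁) ℤ.- + (x * b)
    regroup : ∀ A B Y₁ Y₂ Y₃ → B ℤ.* (Y₁ ℤ.- (ℤ.1ℤ ℤ.+ A) ℤ.* Y₃ ℤ.- A) ℤ.+ (Y₂ ℤ.+ (ℤ.1ℤ ℤ.+ A) ℤ.* B ℤ.* Y₃)
                             ≡ Y₂ ℤ.+ B ℤ.* (ℤ.1ℤ ℤ.+ Y₁) ℤ.- (ℤ.1ℤ ℤ.+ A) ℤ.* B
    regroup = ℤ-solve-∀
    lhs≡rhs : ∀ a₁ → lhs (suc a₁) ≡ rhs (suc a₁)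
    lhs≡rhs a₁ = begin
      lhs (suc a₁)
        ≡⟨ cong₂ (λ u v → + b ℤ.* (+ y₁ ℤ.- u ℤ.- + a₁) ℤ.+ (+ y₂ ℤ.+ v))
                 (ℤP.pos-* (suc a₁) y₃) (trans (ℤP.pos-* (suc a₁ * b) y₃) (cong (ℤ._* + y₃) (ℤP.pos-* (suc a₁) b))) ⟩
      + b ℤ.* (+ y₁ ℤ.- + suc a₁ ℤ.* + y₃ ℤ.- + a₁) ℤ.+ (+ y₂ ℤ.+ + suc a₁ ℤ.* + b ℤ.* + y₃)
        ≡⟨ regroup (+ a₁) (+ b) (+ y₁) (+ y₂) (+ y₃) ⟩
      + y₂ ℤ.+ + b ℤ.* + suc y₁ ℤ.- + suc a₁ ℤ.* + b
        ≡⟨ cong₂ (λ u v → + y₂ ℤ.+ u ℤ.- v) (ℤP.pos-* b (suc y₁)) (ℤP.pos-* (suc a₁) b) ⟨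
      rhs (suc a₁)
        ∎

module Frobenius {d : ℕ} (squarefree : SquareFree d) {β₁ β₂ : K} (basis : IsIntegralBasis d β₁ β₂)
                 (a b : ℕ) .{{_ : NonZero a}} where

  open Coordinates β₁ β₂
  open Independent (proj₂ (proj₂ (proj₂ basis)))

  β₁∈O : InO d β₁
  β₁∈O = proj₁ basis

  β₂∈O : InO d β₂
  β₂∈O = proj₁ (proj₂ basis)

  spanning : ∀ v → InO d v → ∃[ m ] ∃[ n ] v ≡ ⟦ m , n ⟧
  spanning = proj₁ (proj₂ (proj₂ basis))
  open IntegerModel a b

  â b̂ : ℚ
  â = ℕ→ℚ a
  b̂ = ℕ→ℚ b

  α : K
  α = ℕ→ℚ (a * b) · β₂ ⊕ ℚ.- â · β₁

  αs : Vec K 3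
  αs = β₁ ∷ β₂ ∷ α ∷ []

  InConeℚ : ℚ → ℚ → Set
  InConeℚ r s = ℚ.NonNegative s × ℚ.NonNegative (b̂ ℚ.* r ℚ.+ s)

  lincomb-αs : ∀ x₁ x₂ x₃ → lincomb (x₁ ∷ x₂ ∷ x₃ ∷ []) αs ≡ ⟪ x₁ ℚ.+ x₃ ℚ.* ℚ.- â , x₂ ℚ.+ x₃ ℚ.* ℕ→ℚ (a * b) ⟫
  lincomb-αs = lincomb-⟪⟫ (ℚ.- â) (ℕ→ℚ (a * b))

  lincomb-αs-InConeℚ : ∀ x₁ x₂ x₃ → AllNonNeg (x₁ ∷ x₂ ∷ x₃ ∷ []) →
                        InConeℚ (x₁ ℚ.+ x₃ ℚ.* ℚ.- â) (x₂ ℚ.+ x₃ ℚ.* ℕ→ℚ (a * b))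
  lincomb-αs-InConeℚ x₁ x₂ x₃ (x₁≥0 , x₂≥0 , x₃≥0 , _) =
    ℚP.nonNeg+nonNeg⇒nonNeg x₂ {{x₂≥0}} (x₃ ℚ.* ℕ→ℚ (a * b)) {{ℚP.nonNeg*nonNeg⇒nonNeg x₃ {{x₃≥0}} (ℕ→ℚ (a * b)) {{ℕ→ℚ-nonNeg (a * b)}}}} ,
    subst ℚ.NonNegative (sym (begin
      b̂ ℚ.* (x₁ ℚ.+ x₃ ℚ.* ℚ.- â) ℚ.+ (x₂ ℚ.+ x₃ ℚ.* ℕ→ℚ (a * b))   ≡⟨ cong (λ ab → b̂ ℚ.* (x₁ ℚ.+ x₃ ℚ.* ℚ.- â) ℚ.+ (x₂ ℚ.+ x₃ ℚ.* ab)) (ℕ→ℚ-homo-* a b) ⟩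
      b̂ ℚ.* (x₁ ℚ.+ x₃ ℚ.* ℚ.- â) ℚ.+ (x₂ ℚ.+ x₃ ℚ.* (â ℚ.* b̂))     ≡⟨ cancel â b̂ x₁ x₂ x₃ ⟩
      b̂ ℚ.* x₁ ℚ.+ x₂                                                ∎))
      (ℚP.nonNeg+nonNeg⇒nonNeg (b̂ ℚ.* x₁) {{ℚP.nonNeg*nonNeg⇒nonNeg b̂ {{ℕ→ℚ-nonNeg b}} x₁ {{x₁≥0}}}} x₂ {{x₂≥0}})
    where
    cancel : ∀ A B x₁ x₂ x₃ → B ℚ.* (x₁ ℚ.+ x₃ ℚ.* ℚ.- A) ℚ.+ (x₂ ℚ.+ x₃ ℚ.* (A ℚ.* B)) ≡ B ℚ.* x₁ ℚ.+ x₂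
    cancel = solve-∀ ℚ-ring

  Cone-⟪⟫⇒InConeℚ : ∀ r s → Cone αs ⟪ r , s ⟫ → InConeℚ r s
  Cone-⟪⟫⇒InConeℚ r s ((x₁ ∷ x₂ ∷ x₃ ∷ []) , xs≥0 , eq) =
    let r≡ , s≡ = ⟪⟫-injective {r} {s} (trans eq (lincomb-αs x₁ x₂ x₃))
    in subst₂ InConeℚ (sym r≡) (sym s≡) (lincomb-αs-InConeℚ x₁ x₂ x₃ xs≥0)

  -- For r < 0, ⟪ r , s ⟫ = (br + s)β₂ + (−r/a)α.
  InConeℚ⇒Cone-⟪⟫ : ∀ r s → InConeℚ r s → Cone αs ⟪ r , s ⟫
  InConeℚ⇒Cone-⟪⟫ r s (s≥0 , br+s≥0) with ℚP.≤-total 0ℚ r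
  ... | inj₁ 0≤r =
    (r ∷ s ∷ 0ℚ ∷ []) , (ℚ.nonNegative 0≤r , s≥0 , _ , _) ,
    sym (trans (lincomb-αs r s 0ℚ) (cong₂ ⟪_,_⟫ (drop r (ℚ.- â)) (drop s (ℕ→ℚ (a * b)))))
    where
    drop : ∀ x y → x ℚ.+ 0ℚ ℚ.* y ≡ x
    drop = solve-∀ ℚ-ring
  ... | inj₂ r≤0 =
    (0ℚ ∷ b̂ ℚ.* r ℚ.+ s ∷ ℚ.- r ℚ.* â⁻¹ ∷ []) ,
    (_ , br+s≥0 , ℚP.nonNeg*nonNeg⇒nonNeg (ℚ.- r) {{ℚ.nonNegative (ℚP.neg-antimono-≤ r≤0)}} â⁻¹ {{â⁻¹≥0}} , _) ,
    sym (trans (lincomb-αs 0ℚ (b̂ ℚ.* r ℚ.+ s) (ℚ.- r ℚ.* â⁻¹)) (cong₂ ⟪_,_⟫ first second))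
    where
    â⁻¹ : ℚ
    â⁻¹ = proj₁ (ℕ→ℚ-inverse a)
    â⁻¹≥0 : ℚ.NonNegative â⁻¹
    â⁻¹≥0 = proj₁ (proj₂ (ℕ→ℚ-inverse a))
    ââ⁻¹≡1 : â ℚ.* â⁻¹ ≡ 1ℚ
    ââ⁻¹≡1 = proj₂ (proj₂ (ℕ→ℚ-inverse a))
    first-regroup : ∀ r A I → 0ℚ ℚ.+ (ℚ.- r ℚ.* I) ℚ.* ℚ.- A ≡ r ℚ.* (A ℚ.* I)
    first-regroup = solve-∀ ℚ-ring
    first : 0ℚ ℚ.+ (ℚ.- r ℚ.* â⁻¹) ℚ.* ℚ.- â ≡ r
    first = begin
      0ℚ ℚ.+ (ℚ.- r ℚ.* â⁻¹) ℚ.* ℚ.- â   ≡⟨ first-regroup r â â⁻¹ ⟩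
      r ℚ.* (â ℚ.* â⁻¹)                   ≡⟨ cong (r ℚ.*_) ââ⁻¹≡1 ⟩
      r ℚ.* 1ℚ                            ≡⟨ ℚP.*-identityʳ r ⟩
      r                                   ∎
    second-regroup : ∀ r s A B I → (B ℚ.* r ℚ.+ s) ℚ.+ (ℚ.- r ℚ.* I) ℚ.* (A ℚ.* B) ≡ s ℚ.+ B ℚ.* r ℚ.* (1ℚ - A ℚ.* I)
    second-regroup = solve-∀ ℚ-ring
    second-cancel : ∀ s x → s ℚ.+ x ℚ.* (1ℚ - 1ℚ) ≡ s
    second-cancel = solve-∀ ℚ-ring
    second : (b̂ ℚ.* r ℚ.+ s) ℚ.+ (ℚ.- r ℚ.* â⁻¹) ℚ.* ℕ→ℚ (a * b) ≡ s
    second = begin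
      (b̂ ℚ.* r ℚ.+ s) ℚ.+ (ℚ.- r ℚ.* â⁻¹) ℚ.* ℕ→ℚ (a * b)   ≡⟨ cong (λ x → (b̂ ℚ.* r ℚ.+ s) ℚ.+ (ℚ.- r ℚ.* â⁻¹) ℚ.* x) (ℕ→ℚ-homo-* a b) ⟩
      (b̂ ℚ.* r ℚ.+ s) ℚ.+ (ℚ.- r ℚ.* â⁻¹) ℚ.* (â ℚ.* b̂)    ≡⟨ second-regroup r s â b̂ â⁻¹ ⟩
      s ℚ.+ b̂ ℚ.* r ℚ.* (1ℚ - â ℚ.* â⁻¹)                      ≡⟨ cong (λ x → s ℚ.+ b̂ ℚ.* r ℚ.* (1ℚ - x)) ââ⁻¹≡1 ⟩
      s ℚ.+ b̂ ℚ.* r ℚ.* (1ℚ - 1ℚ)                             ≡⟨ second-cancel s (b̂ ℚ.* r) ⟩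
      s                                                        ∎

  ℤ→ℚ-homo-bm+n : ∀ m n → ℤ→ℚ (+ b ℤ.* m ℤ.+ n) ≡ b̂ ℚ.* ℤ→ℚ m ℚ.+ ℤ→ℚ n
  ℤ→ℚ-homo-bm+n m n = trans (ℤ→ℚ-homo-+ (+ b ℤ.* m) n) (cong (ℚ._+ ℤ→ℚ n) (ℤ→ℚ-homo-* (+ b) m))

  InCone⇒Cone-⟦⟧ : ∀ {m n} → InCone m n → Cone αs ⟦ m , n ⟧
  InCone⇒Cone-⟦⟧ {m} {n} (0≤n , 0≤bm+n) =
    InConeℚ⇒Cone-⟪⟫ (ℤ→ℚ m) (ℤ→ℚ n) (ℤ→ℚ-nonNeg 0≤n , subst ℚ.NonNegative (ℤ→ℚ-homo-bm+n m n) (ℤ→ℚ-nonNeg 0≤bm+n))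

  Cone-⟦⟧⇒InCone : ∀ m n → Cone αs ⟦ m , n ⟧ → InCone m n
  Cone-⟦⟧⇒InCone m n mn∈C =
    let n̂≥0 , bm̂+n̂≥0 = Cone-⟪⟫⇒InConeℚ (ℤ→ℚ m) (ℤ→ℚ n) mn∈C
    in ℤ→ℚ-nonNeg⁻¹ n n̂≥0 , ℤ→ℚ-nonNeg⁻¹ (+ b ℤ.* m ℤ.+ n) (subst ℚ.NonNegative (sym (ℤ→ℚ-homo-bm+n m n)) bm̂+n̂≥0)

  InO-⟦⟧ : ∀ m n → InO d ⟦ m , n ⟧
  InO-⟦⟧ m n = InO-⊕ {d} {ℤ→ℚ m · β₁} {ℤ→ℚ n · β₂} squarefree
    (InO-· {d} {ℤ→ℚ m} {β₁} (m , refl) β₁∈O) (InO-· {d} {ℤ→ℚ n} {β₂} (n , refl) β₂∈O)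

  Cone∩O⇒InCone : ∀ {v} → Cone αs v → InO d v → ∃[ m ] ∃[ n ] v ≡ ⟦ m , n ⟧ × InCone m n
  Cone∩O⇒InCone {v} v∈C v∈O =
    let m , n , v≡⟦m,n⟧ = spanning v v∈O
    in m , n , v≡⟦m,n⟧ , Cone-⟦⟧⇒InCone m n (subst (Cone αs) v≡⟦m,n⟧ v∈C)

  lincomb-mapℕ : ∀ y₁ y₂ y₃ → lincomb (mapℕ (y₁ ∷ y₂ ∷ y₃ ∷ [])) αs ≡ ⟦ + y₁ ℤ.- + (a * y₃) , + (y₂ ℕ.+ a * b * y₃) ⟧
  lincomb-mapℕ y₁ y₂ y₃ = trans (lincomb-αs (ℕ→ℚ y₁) (ℕ→ℚ y₂) (ℕ→ℚ y₃)) (cong₂ ⟪_,_⟫ first second)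
    where
    first-regroup : ∀ y₁ y₃ A → y₁ ℚ.+ y₃ ℚ.* ℚ.- A ≡ y₁ ℚ.+ ℚ.- (A ℚ.* y₃)
    first-regroup = solve-∀ ℚ-ring
    first : ℕ→ℚ y₁ ℚ.+ ℕ→ℚ y₃ ℚ.* ℚ.- â ≡ ℤ→ℚ (+ y₁ ℤ.- + (a * y₃))
    first = begin
      ℕ→ℚ y₁ ℚ.+ ℕ→ℚ y₃ ℚ.* ℚ.- â               ≡⟨ first-regroup (ℕ→ℚ y₁) (ℕ→ℚ y₃) â ⟩
      ℕ→ℚ y₁ ℚ.+ ℚ.- (â ℚ.* ℕ→ℚ y₃)             ≡⟨ cong (λ x → ℕ→ℚ y₁ ℚ.+ ℚ.- x) (ℕ→ℚ-homo-* a y₃) ⟨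
      ℕ→ℚ y₁ ℚ.+ ℚ.- ℕ→ℚ (a * y₃)               ≡⟨ cong (ℕ→ℚ y₁ ℚ.+_) (ℤ→ℚ-homo-neg (+ (a * y₃))) ⟨
      ℕ→ℚ y₁ ℚ.+ ℤ→ℚ (ℤ.- + (a * y₃))           ≡⟨ ℤ→ℚ-homo-+ (+ y₁) (ℤ.- + (a * y₃)) ⟨
      ℤ→ℚ (+ y₁ ℤ.- + (a * y₃))                 ∎
    second : ℕ→ℚ y₂ ℚ.+ ℕ→ℚ y₃ ℚ.* ℕ→ℚ (a * b) ≡ ℕ→ℚ (y₂ ℕ.+ a * b * y₃)
    second = begin
      ℕ→ℚ y₂ ℚ.+ ℕ→ℚ y₃ ℚ.* ℕ→ℚ (a * b)        ≡⟨ cong (ℕ→ℚ y₂ ℚ.+_) (ℚP.*-comm (ℕ→ℚ y₃) (ℕ→ℚ (a * b))) ⟩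
      ℕ→ℚ y₂ ℚ.+ ℕ→ℚ (a * b) ℚ.* ℕ→ℚ y₃        ≡⟨ cong (ℕ→ℚ y₂ ℚ.+_) (ℕ→ℚ-homo-* (a * b) y₃) ⟨
      ℕ→ℚ y₂ ℚ.+ ℕ→ℚ (a * b * y₃)              ≡⟨ ℕ→ℚ-homo-+ y₂ (a * b * y₃) ⟨
      ℕ→ℚ (y₂ ℕ.+ a * b * y₃)                  ∎

  SG⇒InSG : ∀ {w} → SG αs w → ∃[ m ] ∃[ n ] w ≡ ⟦ m , n ⟧ × InSG m n
  SG⇒InSG ((y₁ ∷ y₂ ∷ y₃ ∷ []) , w≡) = _ , _ , trans w≡ (lincomb-mapℕ y₁ y₂ y₃) , y₁ , y₂ , y₃ , refl , refl

  InSG⇒SG-⟦⟧ : ∀ {m n} → InSG m n → SG αs ⟦ m , n ⟧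
  InSG⇒SG-⟦⟧ (y₁ , y₂ , y₃ , refl , refl) = (y₁ ∷ y₂ ∷ y₃ ∷ []) , sym (lincomb-mapℕ y₁ y₂ y₃)

  SG-⟦⟧⇒InSG : ∀ m n → SG αs ⟦ m , n ⟧ → InSG m n
  SG-⟦⟧⇒InSG m n mn∈SG =
    let m′ , n′ , ⟦m,n⟧≡⟦m′,n′⟧ , m′n′∈SG = SG⇒InSG mn∈SG
        m≡m′ , n≡n′ = ⟦⟧-injective ⟦m,n⟧≡⟦m′,n′⟧
    in subst₂ InSG (sym m≡m′) (sym n≡n′) m′n′∈SG

  InShiftedCone∩O : K → Set
  InShiftedCone∩O w = ∃[ v ] (Cone αs v × InO d v × (w ≡ ℕ→ℚ (a ∸ 1) · β₁ ⊕ v))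

  shift-⟦⟧ : ∀ m n → ℕ→ℚ (a ∸ 1) · β₁ ⊕ ⟦ m , n ⟧ ≡ ⟦ + (a ∸ 1) ℤ.+ m , n ⟧
  shift-⟦⟧ = ·β₁-⊕-⟦⟧ (+ (a ∸ 1))

  ⟦⟧+C∩O⊆SG⇒InSG : ∀ m n → (∀ v → Cone αs v → InO d v → SG αs (⟦ m , n ⟧ ⊕ v)) →
                    ∀ k → InSG (m ℤ.- + k) (n ℤ.+ + (b * k))
  ⟦⟧+C∩O⊆SG⇒InSG m n ⟦m,n⟧+C∩O⊆SG k =
    SG-⟦⟧⇒InSG (m ℤ.- + k) (n ℤ.+ + (b * k))
      (subst (SG αs) (⟦⟧-⊕ m n (ℤ.- + k) (+ (b * k)))
        (⟦m,n⟧+C∩O⊆SG ⟦ ℤ.- + k , + (b * k) ⟧ (InCone⇒Cone-⟦⟧ (InCone-−k,bk k)) (InO-⟦⟧ (ℤ.- + k) (+ (b * k)))))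

  Frob⇒InShiftedCone∩O : ∀ {w} → Frob d αs w → InShiftedCone∩O w
  Frob⇒InShiftedCone∩O (w∈SG , w+C∩O⊆SG) =
    let m , n , w≡⟦m,n⟧ , mn∈SG = SG⇒InSG w∈SG
        shifts∈SG = ⟦⟧+C∩O⊆SG⇒InSG m n (subst (λ w → ∀ v → Cone αs v → InO d v → SG αs (w ⊕ v)) w≡⟦m,n⟧ w+C∩O⊆SG)
    in ⟦ m ℤ.- + (a ∸ 1) , n ⟧ , InCone⇒Cone-⟦⟧ (frobenius-bound mn∈SG shifts∈SG) , InO-⟦⟧ (m ℤ.- + (a ∸ 1)) n ,
       trans w≡⟦m,n⟧ (sym (trans (shift-⟦⟧ (m ℤ.- + (a ∸ 1)) n) (cong ⟦_, n ⟧ (cancel (+ (a ∸ 1)) m))))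
    where
    cancel : ∀ k m → k ℤ.+ (m ℤ.- k) ≡ m
    cancel = ℤ-solve-∀

  InCone⇒Frob-shift : ∀ m n → InCone m n → Frob d αs (ℕ→ℚ (a ∸ 1) · β₁ ⊕ ⟦ m , n ⟧)
  InCone⇒Frob-shift m n mn∈C =
    subst (SG αs) (sym (shift-⟦⟧ m n)) (InSG⇒SG-⟦⟧ (InCone⇒InSG-shift mn∈C)) ,
    λ v′ v′∈C v′∈O →
      let m′ , n′ , v′≡⟦m′,n′⟧ , m′n′∈C = Cone∩O⇒InCone v′∈C v′∈O
      in subst (SG αs) (sym (begin
           ℕ→ℚ (a ∸ 1) · β₁ ⊕ ⟦ m , n ⟧ ⊕ v′                   ≡⟨ cong₂ _⊕_ (shift-⟦⟧ m n) v′≡⟦m′,n′⟧ ⟩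
           ⟦ + (a ∸ 1) ℤ.+ m , n ⟧ ⊕ ⟦ m′ , n′ ⟧                ≡⟨ ⟦⟧-⊕ (+ (a ∸ 1) ℤ.+ m) n m′ n′ ⟩
           ⟦ + (a ∸ 1) ℤ.+ m ℤ.+ m′ , n ℤ.+ n′ ⟧                ≡⟨ cong ⟦_, n ℤ.+ n′ ⟧ (ℤP.+-assoc (+ (a ∸ 1)) m m′) ⟩
           ⟦ + (a ∸ 1) ℤ.+ (m ℤ.+ m′) , n ℤ.+ n′ ⟧              ∎))
           (InSG⇒SG-⟦⟧ (InCone⇒InSG-shift (InCone-+ mn∈C m′n′∈C)))

  InShiftedCone∩O⇒Frob : ∀ {w} → InShiftedCone∩O w → Frob d αs w
  InShiftedCone∩O⇒Frob (v , v∈C , v∈O , refl) =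
    let m , n , v≡⟦m,n⟧ , mn∈C = Cone∩O⇒InCone v∈C v∈O
    in subst (λ v → Frob d αs (ℕ→ℚ (a ∸ 1) · β₁ ⊕ v)) (sym v≡⟦m,n⟧) (InCone⇒Frob-shift m n mn∈C)

proposition16 : (d : ℕ) → 1 Data.Nat.< d → SquareFree d →
    (β₁ β₂ : K) → InO⁺ d β₁ → InO⁺ d β₂ → IsIntegralBasis d β₁ β₂ →
    (a b : ℕ) → NonZero a → NonZero b →
    let α = (ℕ→ℚ (a * b) · β₂) ⊕ (Data.Rational.-_ (ℕ→ℚ a) · β₁) in
    InO⁺ d α →
    ∀ w → Frob d (β₁ ∷ β₂ ∷ α ∷ []) w
      ⇔ (∃[ v ] (Cone (β₁ ∷ β₂ ∷ α ∷ []) v × InO d v × (w ≡ ℕ→ℚ (a ∸ 1) · β₁ ⊕ v)))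
proposition16 d _ squarefree β₁ β₂ _ _ basis a b a≢0 _ _ w =
  mk⇔ Frob⇒InShiftedCone∩O InShiftedCone∩O⇒Frob
  where open Frobenius squarefree basis a b {{a≢0}}
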